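{- Let $(X,A_\tau,\rightarrow)$ be a labelled transition system. (1) For all states $q_0,q,q',p$: if $q_0\twoheadrightarrow_\tau q\rightarrow_\tau q'$, $q'\mathrel{\#_{sb}}p$, and for all $p',p''$ with $p\twoheadrightarrow_\tau p'\rightarrow_\tau p''$ we have $q'\mathrel{\#_{sb}}p''\vee(q\mathrel{\#_{sb}}p'\wedge q\mathrel{\#_{sb}}p'')$, then $q_0\mathrel{\#_{sb}}p$. (2) For all states $q_0,q,q',p$ and $a\in A$: if $q_0\twoheadrightarrow_\tau q\rightarrow_a q'$ and for all $p',p''$ with $p\twoheadrightarrow_\tau p'\rightarrow_a p''$ we have $q\mathrel{\#_{sb}}p'\vee q'\mathrel{\#_{sb}}p''$, then $q_0\mathrel{\#_{sb}}p$.
   Context: An LTS is a triple $(X,A_\tau,\rightarrow)$ with $X$ a set of states, $A_\tau=A\cup\{\tau\}$ where $\tau\notin A$ is the silent action, and $\rightarrow\subseteq X\times A_\tau\times X$; write $q\rightarrow_u q'$ for $(q,u,q')\in\rightarrow$. $\twoheadrightarrow_\tau$ is the reflexive-transitive closure of $\rightarrow_\tau$. A relation $Q\subseteq X\times X$ is a semi-branching apartness if: (symm) $Q(p,q)\Rightarrow Q(q,p)$; (in$_{sb\tau}$) if $q\rightarrow_\tau q'$, $Q(q',p)$, and for all $p',p''$ with $p\twoheadrightarrow_\tau p'\rightarrow_\tau p''$ we have $Q(q',p'')\vee(Q(q,p')\wedge Q(q,p''))$, then $Q(q,p)$; (in$_b$) for each $a\in A$: if $q\rightarrow_a q'$ and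 for all $p',p''$ with $p\twoheadrightarrow_\tau p'\rightarrow_a p''$ we have $Q(q,p')\vee Q(q',p'')$, then $Q(q,p)$. $q\mathrel{\#_{sb}}p$ means $Q(q,p)$ for every semi-branching apartness $Q$. -}

module Defs where

open import Level using (Level; _⊔_) renaming (suc to lsuc)
open import Data.Maybe using (Maybe; just; nothing)
open import Data.Product using (_×_)
open import Data.Sum using (_⊎_)
open import Relation.Binary.Construct.Closure.ReflexiveTransitive using (Star)

-- A labelled transition system (X, A_τ, →).  The label set A_τ = A ∪ {τ}
-- is represented as Maybe A, with τ = nothing (so τ ∉ A automatically).
record LTS : Set₁ where
  field
    X    : Set
    A    : Set
    step : X → Maybe A → X → Set

module _ (L : LTS) where
  open LTS L

  τ : Maybe A
  τ = nothing

  _→τ_ : X → X → Set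
  q →τ q' = step q τ q'

  _↠τ_ : X → X → Set
  _↠τ_ = Star _→τ_

  record IsSemiBranchingApartness (Q : X → X → Set) : Set where
    field
      symm : ∀ {p q} → Q p q → Q q p
      in-sbτ : ∀ {q q' p} → q →τ q' → Q q' p →
               (∀ p' p'' → p ↠τ p' → p' →τ p'' →
                  Q q' p'' ⊎ (Q q p' × Q q p'')) →
               Q q p
      in-b : ∀ (a : A) {q q' p} → step q (just a) q' →
             (∀ p' p'' → p ↠τ p' → step p' (just a) p'' →
                Q q p' ⊎ Q q' p'') →
             Q q p

  _#sb_ : X → X → Set₁
  q #sb p = ∀ (Q : X → X → Set) → IsSemiBranchingApartness Q → Q q p

-- Both parts reduce to one propagation principle for a semi-branching
-- apartness Q: if Q q p'' holds for p and for every state p'' reached from p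
-- by a weak τ-step, then Q r p holds for every τ-ancestor r of q, by
-- induction on the path r ↠τ q using in-sbτ with its left disjunct.  The
-- required hereditary apartness of q comes from in-b for part (2), and from
-- in-sbτ along q →τ q' for part (1).

module Submission where

open import Defs
open import Data.Maybe using (Maybe; just)
open import Data.Product using (_×_; _,_)
import Data.Product as Product
open import Data.Sum using (_⊎_; inj₁; inj₂)
import Data.Sum as Sum
open import Relation.Binary.Construct.Closure.ReflexiveTransitive using (ε; _◅_; _◅◅_)

module _ (L : LTS) where
  open LTS L

  EveryWeakStep : ∀ {ℓ} → Maybe A → (X → X → Set ℓ) → X → Set ℓ
  EveryWeakStep u R p = ∀ p' p'' → _↠τ_ L p p' → step p' u p'' → R p' p''

  module _ {u : Maybe A} where

    EveryWeakStep-map : ∀ {ℓ ℓ'} {R : X → X → Set ℓ} {R' : X → X → Set ℓ'} {p} →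
                        (∀ {p' p''} → R p' p'' → R' p' p'') →
                        EveryWeakStep u R p → EveryWeakStep u R' p
    EveryWeakStep-map f H p' p'' s v = f (H p' p'' s v)

    EveryWeakStep-↠τ : ∀ {ℓ} {R : X → X → Set ℓ} {p p₀} → _↠τ_ L p p₀ →
                       EveryWeakStep u R p → EveryWeakStep u R p₀
    EveryWeakStep-↠τ s₀ H p' p'' s v = H p' p'' (s₀ ◅◅ s) v

  module _ {Q : X → X → Set} (isQ : IsSemiBranchingApartness L Q) where
    open IsSemiBranchingApartness isQ

    apart-from-τ-ancestors : ∀ {q p r} → Q q p → EveryWeakStep (τ L) (λ _ p'' → Q q p'') p →
                             _↠τ_ L r q → Q r p
    apart-from-τ-ancestors qp H ε = qp
    apart-from-τ-ancestors qp H (t ◅ path) =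
      in-sbτ t (apart-from-τ-ancestors qp H path) λ p' p'' s v →
        inj₁ (apart-from-τ-ancestors (H p' p'' s v) (EveryWeakStep-↠τ (s ◅◅ v ◅ ε) H) path)

    in-sbτ-hereditary : ∀ {q q' p} → _→τ_ L q q' →
                        EveryWeakStep (τ L) (λ p' p'' → Q q' p'' ⊎ (Q q p' × Q q p'')) p →
                        EveryWeakStep (τ L) (λ _ p'' → Q q p'') p
    in-sbτ-hereditary t H p' p'' s v with H p' p'' s v
    ... | inj₁ q'p'' = in-sbτ t q'p'' (EveryWeakStep-↠τ (s ◅◅ v ◅ ε) H)
    ... | inj₂ (_ , qp'') = qp''

    in-b-hereditary : ∀ (a : A) {q q' p} → step q (just a) q' →
                      EveryWeakStep (just a) (λ p' p'' → Q q p' ⊎ Q q' p'') p →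
                      EveryWeakStep (τ L) (λ _ p'' → Q q p'') p
    in-b-hereditary a t H p' p'' s v = in-b a t (EveryWeakStep-↠τ (s ◅◅ v ◅ ε) H)

corollary3p19 : (L : LTS) → let open LTS L in
    (∀ (q₀ q q' p : X) → _↠τ_ L q₀ q → _→τ_ L q q' → _#sb_ L q' p →
      (∀ p' p'' → _↠τ_ L p p' → _→τ_ L p' p'' →
        _#sb_ L q' p'' ⊎ (_#sb_ L q p' × _#sb_ L q p'')) →
      _#sb_ L q₀ p)
    ×
    (∀ (q₀ q q' p : X) (a : A) → _↠τ_ L q₀ q → step q (just a) q' →
      (∀ p' p'' → _↠τ_ L p p' → step p' (just a) p'' →
        _#sb_ L q p' ⊎ _#sb_ L q' p'') →
      _#sb_ L q₀ p)
corollary3p19 L =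
  (λ q₀ q q' p path t q'p H Q isQ →
    let H_Q = EveryWeakStep-map L (Sum.map (λ h → h Q isQ) (Product.map (λ h → h Q isQ) (λ h → h Q isQ))) H
    in apart-from-τ-ancestors L isQ (in-sbτ isQ t (q'p Q isQ) H_Q) (in-sbτ-hereditary L isQ t H_Q) path) ,
  (λ q₀ q q' p a path t H Q isQ →
    let H_Q = EveryWeakStep-map L (Sum.map (λ h → h Q isQ) (λ h → h Q isQ)) H
    in apart-from-τ-ancestors L isQ (in-b isQ a t H_Q) (in-b-hereditary L isQ a t H_Q) path)
  where open IsSemiBranchingApartness
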